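{- Let $\mathbf{s}=(s_1,\dots,s_n)$ be a sequence of positive integers and $\mathbf{q}=(q_1,\dots,q_n)\in\Psi_n$. Then both $\operatorname{REM}_{\mathbf{s}}^{\mathbf{q}}$ and $\overline{\operatorname{REM}}_{\mathbf{s}}^{\mathbf{q}}$ are bijections from $\operatorname{Par}_{\mathbf{s}}\cap\mathbb{Z}^n$ to $\Psi_n$.
   Context: $\langle N\rangle=\{0,\dots,N\}$, $\Psi_n=\langle s_1-1\rangle\times\cdots\times\langle s_n-1\rangle$. $\operatorname{Par}_{\mathbf{s}}=\{\sum_{j=1}^n c_j\mathbf{w}_j:0\le c_j<1\}$ with $\mathbf{w}_j=(0,\dots,0,s_j,\dots,s_n)$ ($j-1$ leading zeros). $\operatorname{REM}_{\mathbf{s}}^{\mathbf{q}}(\mathbf{x})=(y_1,\dots,y_n)$ with $y_i\in\langle s_i-1\rangle$, $y_i\equiv x_i+q_i\pmod{s_i}$; $\overline{\operatorname{REM}}_{\mathbf{s}}^{\mathbf{q}}(\mathbf{x})=(z_1,\dots,z_n)$ with $z_i\in\langle s_i-1\rangle$, $x_i+z_i\equiv q_i\pmod{s_i}$. -}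

module Defs where

open import Data.Nat as ℕ using (ℕ; zero; suc; _<_; _≤_; NonZero; >-nonZero)
open import Data.Integer as ℤ using (ℤ; +_)
open import Data.Integer.DivMod using (_%ℕ_)
open import Data.Rational as ℚ using (ℚ)
open import Data.Fin using (Fin; toℕ) renaming (zero to fzero; suc to fsuc)
open import Data.Product using (Σ; _×_; ∃)
open import Relation.Binary.PropositionalEquality using (_≡_)
open import Relation.Nullary using (does)
open import Data.Bool using (if_then_else_)

sumFin : ∀ {n} → (Fin n → ℚ) → ℚ
sumFin {zero}  f = ℚ.0ℚ
sumFin {suc n} f = f fzero ℚ.+ sumFin (λ j → f (fsuc j))

Positive : ∀ {n} → (Fin n → ℕ) → Set
Positive s = ∀ i → 0 < s i

InΨ : ∀ {n} → (s : Fin n → ℕ) → (Fin n → ℕ) → Set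
InΨ s y = ∀ i → y i < s i

w : ∀ {n} → (Fin n → ℕ) → Fin n → Fin n → ℚ
w s j i = if does (toℕ j ℕ.≤? toℕ i) then (+ s i ℚ./ 1) else ℚ.0ℚ

InPar : ∀ {n} → (Fin n → ℕ) → (Fin n → ℤ) → Set
InPar {n} s x =
  Σ (Fin n → ℚ) λ c →
    (∀ j → ℚ.0ℚ ℚ.≤ c j) × (∀ j → c j ℚ.< ℚ.1ℚ) ×
    (∀ i → (x i ℚ./ 1) ≡ sumFin (λ j → c j ℚ.* w s j i))

REM : ∀ {n} (s : Fin n → ℕ) → Positive s → (q : Fin n → ℕ) →
      (Fin n → ℤ) → (Fin n → ℕ)
REM s pos q x i = _%ℕ_ (x i ℤ.+ + q i) (s i) {{>-nonZero (pos i)}}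

REMbar : ∀ {n} (s : Fin n → ℕ) → Positive s → (q : Fin n → ℕ) →
         (Fin n → ℤ) → (Fin n → ℕ)
REMbar s pos q x i = _%ℕ_ (+ q i ℤ.- x i) (s i) {{>-nonZero (pos i)}}

BijParΨ : ∀ {n} (s : Fin n → ℕ) → ((Fin n → ℤ) → (Fin n → ℕ)) → Set
BijParΨ {n} s f =
  (∀ x → InPar s x → InΨ s (f x)) ×
  (∀ x x′ → InPar s x → InPar s x′ → (∀ i → f x i ≡ f x′ i) → ∀ i → x i ≡ x′ i) ×
  (∀ y → InΨ s y → ∃ λ x → InPar s x × (∀ i → f x i ≡ y i))

module Submission where

-- A point of Par_s has coordinates x_i = (c_1 + ⋯ + c_i)·s_i with c_j ∈ [0,1).
-- Reading the coordinates from left to right with the running offset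
-- a = c_1 + ⋯ + c_{i-1}, the admissible values of x_i are the integers of the
-- interval [a·s_i, (a+1)·s_i), i.e. the s_i consecutive integers starting at
-- ⌈a·s_i⌉, and x_i determines the next offset a + c_i = x_i / s_i.  In every
-- coordinate both maps are "residue labellings" z ↦ (±z + q_i) mod s_i, and such a
-- labelling is a bijection from any s_i consecutive integers onto {0,…,s_i-1}.
-- Injectivity and surjectivity therefore follow by induction on n, carrying the
-- offset along.

open import Data.Nat as ℕ using (ℕ; zero; suc; NonZero; >-nonZero; z≤n)
import Data.Nat.Properties as ℕP
open import Data.Nat.DivMod using (m<n⇒m%n≡m)
open import Data.Nat.Divisibility using (n∣m⇒m%n≡0)
open import Data.Integer as ℤ using (ℤ; +_; -[1+_]; +[1+_]; _+_; _*_; _-_; -_; _≤_; _<_; ∣_∣)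
import Data.Integer.Properties as ℤP
open import Data.Integer.DivMod
  using (_%ℕ_; _/ℕ_; n%ℕd<d; a≡a%ℕn+[a/ℕn]*n; div-pos-is-/ℕ; [n/ℕd]*d≤n; n<s[n/ℕd]*d)
open import Data.Integer.Divisibility.Signed
  using (_∣_; divides; ∣⇒∣ᵤ; ∣m⇒∣-m; ∣m∣n⇒∣m+n; ∣m+n∣n⇒∣m)
open import Data.Integer.Tactic.RingSolver using (solve-∀)
open import Data.Rational as ℚ using (ℚ; mkℚ; ↥_; ↧ₙ_; 0ℚ; 1ℚ)
import Data.Rational.Properties as ℚP
open import Data.Rational.Literals using (fromℤ)
open import Data.Rational.Solver using (module +-*-Solver)
open import Data.Fin using (Fin; toℕ) renaming (zero to fzero; suc to fsuc)
open import Data.Vec.Functional using (_∷_; tail)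
open import Data.Bool using (if_then_else_)
open import Data.Product using (Σ; _×_; ∃; _,_; proj₁; proj₂)
open import Relation.Binary.PropositionalEquality
open import Defs

-- At use
-- sites its argument is given explicitly whenever it cannot be read off a
-- neighbouring type: solving ι ?a = ι b would unfold the gcd normalisation of ℚ.
ι : ℤ → ℚ
ι z = z ℚ./ 1

-- ι agrees with the library's fromℤ, which makes it an order embedding and
-- additive.
ι≡fromℤ : ∀ z → ι z ≡ fromℤ z
ι≡fromℤ z = ℚP.↥p/↧p≡p (fromℤ z)

ι-mono-≤ : ∀ {a b} → a ≤ b → ι a ℚ.≤ ι b
ι-mono-≤ {a} {b} a≤b rewrite ι≡fromℤ a | ι≡fromℤ b =
  ℚ.*≤* (subst₂ _≤_ (sym (ℤP.*-identityʳ a)) (sym (ℤP.*-identityʳ b)) a≤b)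

ι-cancel-< : ∀ {a b} → ι a ℚ.< ι b → a < b
ι-cancel-< {a} {b} ιa<ιb rewrite ι≡fromℤ a | ι≡fromℤ b =
  subst₂ _<_ (ℤP.*-identityʳ a) (ℤP.*-identityʳ b) (ℚP.drop-*<* ιa<ιb)

ι-+ : ∀ a b → ι (a + b) ≡ ι a ℚ.+ ι b
ι-+ a b = begin
  (a + b) ℚ./ 1        ≡⟨ cong₂ (λ u v → (u + v) ℚ./ 1) (sym (ℤP.*-identityʳ a)) (sym (ℤP.*-identityʳ b)) ⟩
  fromℤ a ℚ.+ fromℤ b  ≡⟨ cong₂ ℚ._+_ (ι≡fromℤ a) (ι≡fromℤ b) ⟨
  ι a ℚ.+ ι b          ∎
  where open ≡-Reasoning

ι-positive : ∀ S .{{_ : NonZero S}} → ℚ.Positive (ι (+ S))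
ι-positive (suc m) rewrite ι≡fromℤ (+ suc m) = _

-- The library's ceiling ⌈p⌉ = -⌊-p⌋ unfolded to division by a natural, whose
-- bounds q·d ≤ n < (q+1)·d yield ι(⌈p⌉ - 1) < p ≤ ι ⌈p⌉.
ceiling-/ℕ : ∀ p → ℚ.ceiling p ≡ - ((- ↥ p) /ℕ ↧ₙ p)
ceiling-/ℕ (mkℚ n@(-[1+ _ ]) d _) = cong -_ (div-pos-is-/ℕ (- n) (suc d))
ceiling-/ℕ (mkℚ n@(+ zero)   d _) = cong -_ (div-pos-is-/ℕ (- n) (suc d))
ceiling-/ℕ (mkℚ n@(+[1+ _ ]) d _) = cong -_ (div-pos-is-/ℕ (- n) (suc d))

p≤⌈p⌉ : ∀ p → p ℚ.≤ ι (ℚ.ceiling p)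
p≤⌈p⌉ p@(mkℚ n d _) rewrite ι≡fromℤ (ℚ.ceiling p) | ceiling-/ℕ p = ℚ.*≤* (begin
  n * + 1          ≡⟨ ℤP.*-identityʳ n ⟩
  n                ≡⟨ ℤP.neg-involutive n ⟨
  - - n            ≤⟨ ℤP.neg-mono-≤ ([n/ℕd]*d≤n (- n) (suc d)) ⟩
  - (Q * + suc d)  ≡⟨ ℤP.neg-distribˡ-* Q (+ suc d) ⟩
  - Q * + suc d    ∎)
  where
  open ℤP.≤-Reasoning
  Q = (- n) /ℕ suc d

⌈p⌉-1<p : ∀ p → ι (ℚ.ceiling p - + 1) ℚ.< p
⌈p⌉-1<p p@(mkℚ n d _) rewrite ι≡fromℤ (ℚ.ceiling p - + 1) | ceiling-/ℕ p = ℚ.*<* (begin-strict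
  (- Q - + 1) * + suc d  ≡⟨ negated Q (+ suc d) ⟩
  - (ℤ.suc Q * + suc d)  <⟨ ℤP.neg-mono-< (n<s[n/ℕd]*d (- n) (suc d)) ⟩
  - - n                  ≡⟨ ℤP.neg-involutive n ⟩
  n                      ≡⟨ ℤP.*-identityʳ n ⟨
  n * + 1                ∎)
  where
  open ℤP.≤-Reasoning
  Q = (- n) /ℕ suc d
  negated : ∀ q e → (- q - + 1) * e ≡ - ((+ 1 + q) * e)
  negated = solve-∀

-- Two numbers below S that are congruent modulo S coincide: their distance is
-- a multiple of S below S.
congruent-below⇒≡ : ∀ {S m n} → m ℕ.< S → n ℕ.< S → + S ∣ + m - + n → m ≡ n
congruent-below⇒≡ {S} {m} {n} m<S n<S S∣m-n =
  ℤP.+-injective (ℤP.i-j≡0⇒i≡j (+ m) (+ n) (ℤP.∣i∣≡0⇒i≡0 ∣m-n∣≡0))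
  where
  instance
    S≢0 : NonZero S
    S≢0 = >-nonZero (ℕP.≤-<-trans z≤n m<S)
  ∣m-n∣<S : ∣ + m - + n ∣ ℕ.< S
  ∣m-n∣<S = subst (ℕ._< S) (cong ∣_∣ (sym (ℤP.m-n≡m⊖n m n)))
              (ℕP.≤-<-trans (ℤP.∣m⊝n∣≤m⊔n m n) (ℕP.⊔-lub m<S n<S))
  ∣m-n∣≡0 : ∣ + m - + n ∣ ≡ 0
  ∣m-n∣≡0 = trans (sym (m<n⇒m%n≡m ∣m-n∣<S)) (n∣m⇒m%n≡0 _ S (∣⇒∣ᵤ S∣m-n))

-- A labelling g : ℤ → ℕ is a residue labelling modulo S when it induces a
-- bijection ℤ/Sℤ ≅ {0,…,S-1}.
record ResidueLabelling (S : ℕ) (g : ℤ → ℕ) : Set where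
  field
    label<S    : ∀ z → g z ℕ.< S
    separates  : ∀ {z z′} → g z ≡ g z′ → + S ∣ z - z′
    respects   : ∀ {z z′} → + S ∣ z - z′ → g z ≡ g z′
    surjective : ∀ {y} → y ℕ.< S → ∃ λ z → g z ≡ y

open ResidueLabelling

representations-differ : ∀ {z z′} r r′ q q′ S → z ≡ r + q * S → z′ ≡ r′ + q′ * S →
                         z - z′ ≡ (r - r′) + (q - q′) * S
representations-differ r r′ q q′ S refl refl = regroup r r′ q q′ S
  where
  regroup : ∀ r r′ q q′ S → (r + q * S) - (r′ + q′ * S) ≡ (r - r′) + (q - q′) * S
  regroup = solve-∀

remainder-labelling : ∀ S .{{_ : NonZero S}} → ResidueLabelling S (λ z → z %ℕ S)
remainder-labelling S = record
  { label<S    = λ z → n%ℕd<d z S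
  ; separates  = λ {z} {z′} r≡r′ → subst (+ S ∣_) (sym (split z z′))
                   (∣m∣n⇒∣m+n (divides ℤ.0ℤ (remainders-cancel z z′ r≡r′)) (divides (z /ℕ S - z′ /ℕ S) refl))
  ; respects   = λ {z} {z′} S∣z-z′ → congruent-below⇒≡ (n%ℕd<d z S) (n%ℕd<d z′ S)
                   (∣m+n∣n⇒∣m (subst (+ S ∣_) (split z z′) S∣z-z′) (divides (z /ℕ S - z′ /ℕ S) refl))
  ; surjective = λ {y} y<S → + y , m<n⇒m%n≡m y<S
  }
  where
  split : ∀ z z′ → z - z′ ≡ (+ (z %ℕ S) - + (z′ %ℕ S)) + (z /ℕ S - z′ /ℕ S) * + S
  split z z′ = representations-differ (+ (z %ℕ S)) (+ (z′ %ℕ S)) (z /ℕ S) (z′ /ℕ S) (+ S)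
                 (a≡a%ℕn+[a/ℕn]*n z S) (a≡a%ℕn+[a/ℕn]*n z′ S)
  remainders-cancel : ∀ z z′ → z %ℕ S ≡ z′ %ℕ S → + (z %ℕ S) - + (z′ %ℕ S) ≡ ℤ.0ℤ * + S
  remainders-cancel z z′ r≡r′ rewrite r≡r′ = ℤP.+-inverseʳ (+ (z′ %ℕ S))

translate : ∀ {S g} t → ResidueLabelling S g → ResidueLabelling S (λ z → g (z + t))
translate {S} {g} t R = record
  { label<S    = λ z → label<S R (z + t)
  ; separates  = λ {z} {z′} eq → subst (+ S ∣_) (shift z z′ t) (separates R eq)
  ; respects   = λ {z} {z′} S∣z-z′ → respects R (subst (+ S ∣_) (sym (shift z z′ t)) S∣z-z′)
  ; surjective = λ y<S → let (u , gu≡y) = surjective R y<S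
                          in u - t , trans (cong g (unshift u t)) gu≡y
  }
  where
  shift : ∀ z z′ t → (z + t) - (z′ + t) ≡ z - z′
  shift = solve-∀
  unshift : ∀ u t → (u - t) + t ≡ u
  unshift = solve-∀

reflect : ∀ {S g} t → ResidueLabelling S g → ResidueLabelling S (λ z → g (t - z))
reflect {S} {g} t R = record
  { label<S    = λ z → label<S R (t - z)
  ; separates  = λ {z} {z′} eq → subst (+ S ∣_) (ℤP.neg-involutive (z - z′))
                   (∣m⇒∣-m (subst (+ S ∣_) (flip t z z′) (separates R eq)))
  ; respects   = λ {z} {z′} S∣z-z′ → respects R (subst (+ S ∣_) (sym (flip t z z′)) (∣m⇒∣-m S∣z-z′))
  ; surjective = λ y<S → let (u , gu≡y) = surjective R y<S
                          in t - u , trans (cong g (unflip t u)) gu≡y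
  }
  where
  flip : ∀ t z z′ → (t - z) - (t - z′) ≡ - (z - z′)
  flip = solve-∀
  unflip : ∀ t u → t - (t - u) ≡ u
  unflip = solve-∀

module Window {S g} (R : ResidueLabelling S g) where

  instance
    S≢0 : NonZero S
    S≢0 = >-nonZero (ℕP.≤-<-trans z≤n (label<S R ℤ.0ℤ))

  window-injective : ∀ L {k k′} → k ℕ.< S → k′ ℕ.< S → g (L + + k) ≡ g (L + + k′) → k ≡ k′
  window-injective L {k} {k′} k<S k′<S eq =
    congruent-below⇒≡ k<S k′<S (subst (+ S ∣_) (cancel L (+ k) (+ k′)) (separates R eq))
    where
    cancel : ∀ L a b → (L + a) - (L + b) ≡ a - b
    cancel = solve-∀

  -- Any preimage u of y is moved into the window by a multiple of S.
  window-surjective : ∀ L {y} → y ℕ.< S → ∃ λ k → k ℕ.< S × g (L + + k) ≡ y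
  window-surjective L y<S with surjective R y<S
  ... | u , gu≡y = k , n%ℕd<d (u - L) S , trans (respects R (divides (- Q) moved)) gu≡y
    where
    k = (u - L) %ℕ S
    Q = (u - L) /ℕ S
    moved : (L + + k) - u ≡ - Q * + S
    moved = begin
      (L + + k) - u            ≡⟨ reorder L (+ k) u ⟩
      + k - (u - L)            ≡⟨ cong (λ t → + k - t) (a≡a%ℕn+[a/ℕn]*n (u - L) S) ⟩
      + k - (+ k + Q * + S)    ≡⟨ collapse (+ k) Q (+ S) ⟩
      - Q * + S                ∎
      where
      open ≡-Reasoning
      reorder : ∀ L k u → (L + k) - u ≡ k - (u - L)
      reorder = solve-∀
      collapse : ∀ k Q S → k - (k + Q * S) ≡ - Q * S
      collapse = solve-∀

window-offset : ∀ {L z S} → L ≤ z → z < L + + S → ∃ λ k → k ℕ.< S × z ≡ L + + k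
window-offset {L} {z} {S} L≤z z<L+S = ∣ z - L ∣ , ℤP.drop‿+<+ k<S , sym (trans (cong (λ t → L + t) k≡) (regroup L z))
  where
  k≡ : + ∣ z - L ∣ ≡ z - L
  k≡ = ℤP.0≤i⇒+∣i∣≡i (ℤP.i≤j⇒0≤j-i L≤z)
  regroup : ∀ L z → L + (z - L) ≡ z
  regroup = solve-∀
  drop-L : ∀ L S → (L + S) - L ≡ S
  drop-L = solve-∀
  k<S : + ∣ z - L ∣ < + S
  k<S = subst₂ _<_ (sym k≡) (drop-L L (+ S)) (ℤP.+-monoˡ-< (- L) z<L+S)

interval⇒window : ∀ S p {z} → p ℚ.≤ ι z → ι z ℚ.< p ℚ.+ ι (+ S) →
                  ∃ λ k → k ℕ.< S × z ≡ ℚ.ceiling p + + k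
interval⇒window S p {z} p≤z z<p+S = window-offset ⌈p⌉≤z z<⌈p⌉+S
  where
  L = ℚ.ceiling p
  L-1+1 : ∀ L → + 1 + (L - + 1) ≡ L
  L-1+1 = solve-∀
  ⌈p⌉≤z : L ≤ z
  ⌈p⌉≤z = subst (_≤ z) (L-1+1 L) (ℤP.i<j⇒suc[i]≤j (ι-cancel-< {L - + 1} {z} (ℚP.<-≤-trans (⌈p⌉-1<p p) p≤z)))
  z<⌈p⌉+S : z < L + + S
  z<⌈p⌉+S = ι-cancel-< (ℚP.<-≤-trans z<p+S
              (subst (p ℚ.+ ι (+ S) ℚ.≤_) (sym (ι-+ L (+ S))) (ℚP.+-monoˡ-≤ (ι (+ S)) (p≤⌈p⌉ p))))

window⇒interval : ∀ S p {k} → k ℕ.< S →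
                  p ℚ.≤ ι (ℚ.ceiling p + + k) × ι (ℚ.ceiling p + + k) ℚ.< p ℚ.+ ι (+ S)
window⇒interval S p {k} k<S =
  ℚP.≤-trans (p≤⌈p⌉ p) (ι-mono-≤ (ℤP.i≤i+j L (+ k))) ,
  ℚP.≤-<-trans (ι-mono-≤ L+k≤L-1+S)
    (subst (ℚ._< p ℚ.+ ι (+ S)) (sym (ι-+ (L - + 1) (+ S))) (ℚP.+-monoˡ-< (ι (+ S)) (⌈p⌉-1<p p)))
  where
  L = ℚ.ceiling p
  pred-left : ∀ L k → L + k ≡ (L + (+ 1 + k)) - + 1
  pred-left = solve-∀
  pred-right : ∀ L S → (L + S) - + 1 ≡ (L - + 1) + S
  pred-right = solve-∀
  L+k≤L-1+S : L + + k ≤ (L - + 1) + + S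
  L+k≤L-1+S = subst₂ _≤_ (sym (pred-left L (+ k))) (pred-right L (+ S))
                (ℤP.+-monoˡ-≤ (- + 1) (ℤP.+-monoʳ-≤ L (ℤ.+≤+ k<S)))

-- z is an admissible coordinate after the offset a when z = b·S for some
-- b ∈ [a, a + 1); b is the offset handed on to the next coordinate.
record Step (S : ℕ) (a : ℚ) (z : ℤ) : Set where
  constructor step
  field
    next     : ℚ
    a≤next   : a ℚ.≤ next
    next<a+1 : next ℚ.< a ℚ.+ 1ℚ
    scaled   : ι z ≡ next ℚ.* ι (+ S)

open Step

module Admissible (S : ℕ) .{{_ : NonZero S}} where

  private
    σ : ℚ
    σ = ι (+ S)
    instance
      σ>0 : ℚ.Positive σ
      σ>0 = ι-positive S
      σ≥0 : ℚ.NonNegative σ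
      σ≥0 = ℚP.pos⇒nonNeg σ

  [a+1]σ : ∀ a → (a ℚ.+ 1ℚ) ℚ.* σ ≡ a ℚ.* σ ℚ.+ σ
  [a+1]σ a = trans (ℚP.*-distribʳ-+ σ a 1ℚ) (cong (a ℚ.* σ ℚ.+_) (ℚP.*-identityˡ σ))

  -- The next offset is determined by the coordinate: cancel the factor S.
  scale-injective : ∀ {b b′} → b ℚ.* σ ≡ b′ ℚ.* σ → b ≡ b′
  scale-injective e = ℚP.≤-antisym (ℚP.*-cancelʳ-≤-pos σ (ℚP.≤-reflexive e))
                                   (ℚP.*-cancelʳ-≤-pos σ (ℚP.≤-reflexive (sym e)))

  step⇒interval : ∀ {a z} → Step S a z → a ℚ.* σ ℚ.≤ ι z × ι z ℚ.< a ℚ.* σ ℚ.+ σ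
  step⇒interval {a} (step b a≤b b<a+1 z≡bσ) =
    subst (a ℚ.* σ ℚ.≤_) (sym z≡bσ) (ℚP.*-monoʳ-≤-nonNeg σ a≤b) ,
    subst₂ ℚ._<_ (sym z≡bσ) ([a+1]σ a) (ℚP.*-monoˡ-<-pos σ b<a+1)

  interval⇒step : ∀ {a z} → a ℚ.* σ ℚ.≤ ι z → ι z ℚ.< a ℚ.* σ ℚ.+ σ → Step S a z
  interval⇒step {a} {z} lower upper = step b
    (ℚP.*-cancelʳ-≤-pos σ (subst (a ℚ.* σ ℚ.≤_) (sym bσ≡z) lower))
    (ℚP.*-cancelʳ-<-nonNeg σ (subst₂ ℚ._<_ (sym bσ≡z) (sym ([a+1]σ a)) upper))
    (sym bσ≡z)
    where
    instance
      σ≢0 : ℚ.NonZero σ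
      σ≢0 = ℚP.pos⇒nonZero σ
    b = ι z ℚ.* ℚ.1/ σ
    bσ≡z : b ℚ.* σ ≡ ι z
    bσ≡z = trans (ℚP.*-assoc (ι z) (ℚ.1/ σ) σ)
             (trans (cong (ι z ℚ.*_) (ℚP.*-inverseˡ σ)) (ℚP.*-identityʳ (ι z)))

  step⇒window : ∀ {a z} → Step S a z → ∃ λ k → k ℕ.< S × z ≡ ℚ.ceiling (a ℚ.* σ) + + k
  step⇒window {a} {z} st = let (lower , upper) = step⇒interval st in interval⇒window S (a ℚ.* σ) {z} lower upper

  window⇒step : ∀ a {k} → k ℕ.< S → Step S a (ℚ.ceiling (a ℚ.* σ) + + k)
  window⇒step a {k} k<S = let (lower , upper) = window⇒interval S (a ℚ.* σ) k<S
                          in interval⇒step {a} {ℚ.ceiling (a ℚ.* σ) + + k} lower upper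

  step-injective : ∀ {g a z z′} → ResidueLabelling S g → Step S a z → Step S a z′ →
                   g z ≡ g z′ → z ≡ z′
  step-injective {g} {a} R st st′ gz≡gz′ =
    let (k , k<S , z≡L+k) = step⇒window st
        (k′ , k′<S , z′≡L+k′) = step⇒window st′
        k≡k′ = Window.window-injective R L k<S k′<S
                 (trans (cong g (sym z≡L+k)) (trans gz≡gz′ (cong g z′≡L+k′)))
    in trans z≡L+k (trans (cong (λ k → L + + k) k≡k′) (sym z′≡L+k′))
    where
    L = ℚ.ceiling (a ℚ.* σ)

  step-surjective : ∀ {g} a {y} → ResidueLabelling S g → y ℕ.< S →
                    ∃ λ z → Step S a z × g z ≡ y
  step-surjective a R y<S =
    let (k , k<S , gz≡y) = Window.window-surjective R (ℚ.ceiling (a ℚ.* σ)) y<S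
    in ℚ.ceiling (a ℚ.* σ) + + k , window⇒step a k<S , gz≡y

-- Par_s shifted by an offset a ∈ ℚ, on integer points:
-- x ∈ a·s + Par_s  iff  x_i = a·s_i + Σ_j c_j (w_j)_i  for some c ∈ [0,1)^n.
ParFrom : ∀ {n} → ℚ → (Fin n → ℕ) → (Fin n → ℤ) → Set
ParFrom {n} a s x =
  Σ (Fin n → ℚ) λ c → (∀ j → 0ℚ ℚ.≤ c j) × (∀ j → c j ℚ.< 1ℚ) ×
    (∀ i → ι (x i) ≡ a ℚ.* ι (+ s i) ℚ.+ sumFin (λ j → c j ℚ.* w s j i))

zero-offset : ∀ σ t → 0ℚ ℚ.* σ ℚ.+ t ≡ t
zero-offset σ t = trans (cong (ℚ._+ t) (ℚP.*-zeroˡ σ)) (ℚP.+-identityˡ t)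

InPar⇒ParFrom0 : ∀ {n} {s : Fin n → ℕ} {x} → InPar s x → ParFrom 0ℚ s x
InPar⇒ParFrom0 {s = s} (c , 0≤c , c<1 , eq) =
  c , 0≤c , c<1 , λ i → trans (eq i) (sym (zero-offset (ι (+ s i)) _))

ParFrom0⇒InPar : ∀ {n} {s : Fin n → ℕ} {x} → ParFrom 0ℚ s x → InPar s x
ParFrom0⇒InPar {s = s} (c , 0≤c , c<1 , eq) =
  c , 0≤c , c<1 , λ i → trans (eq i) (zero-offset (ι (+ s i)) _)

sumFin-cong : ∀ {n} {f g : Fin n → ℚ} → (∀ j → f j ≡ g j) → sumFin f ≡ sumFin g
sumFin-cong {zero}  f≡g = refl
sumFin-cong {suc n} f≡g = cong₂ ℚ._+_ (f≡g fzero) (sumFin-cong (λ j → f≡g (fsuc j)))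

sumFin-zero : ∀ {n} {f : Fin n → ℚ} → (∀ j → f j ≡ 0ℚ) → sumFin f ≡ 0ℚ
sumFin-zero {zero}  f≡0 = refl
sumFin-zero {suc n} f≡0 =
  trans (cong₂ ℚ._+_ (f≡0 fzero) (sumFin-zero (λ j → f≡0 (fsuc j)))) (ℚP.+-identityʳ 0ℚ)

-- Comparing successors is comparing predecessors (as boolean tests, which is how
-- the generators w_j decide whether j ≤ i).
≤ᵇ-suc : ∀ m n → (suc m ℕ.≤ᵇ suc n) ≡ (m ℕ.≤ᵇ n)
≤ᵇ-suc zero    n = refl
≤ᵇ-suc (suc m) n = refl

w-tail : ∀ {n} (s : Fin (suc n) → ℕ) j i → w s (fsuc j) (fsuc i) ≡ w (tail s) j i
w-tail s j i = cong (λ b → if b then ι (+ s (fsuc i)) else 0ℚ) (≤ᵇ-suc (toℕ j) (toℕ i))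

-- a·σ + c·σ + t = (a + c)·σ + t: the first coefficient is absorbed into the offset.
absorb : ∀ a c σ t → a ℚ.* σ ℚ.+ (c ℚ.* σ ℚ.+ t) ≡ (a ℚ.+ c) ℚ.* σ ℚ.+ t
absorb a c σ t = trans (sym (ℚP.+-assoc (a ℚ.* σ) (c ℚ.* σ) t))
                       (cong (ℚ._+ t) (sym (ℚP.*-distribʳ-+ σ a c)))

first-coordinate : ∀ {n} a (c : Fin (suc n) → ℚ) (s : Fin (suc n) → ℕ) →
  a ℚ.* ι (+ s fzero) ℚ.+ sumFin (λ j → c j ℚ.* w s j fzero) ≡ (a ℚ.+ c fzero) ℚ.* ι (+ s fzero)
first-coordinate a c s = begin
  a ℚ.* σ ℚ.+ (c fzero ℚ.* σ ℚ.+ sumFin (λ j → c (fsuc j) ℚ.* 0ℚ))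
    ≡⟨ cong (λ t → a ℚ.* σ ℚ.+ (c fzero ℚ.* σ ℚ.+ t)) (sumFin-zero (λ j → ℚP.*-zeroʳ (c (fsuc j)))) ⟩
  a ℚ.* σ ℚ.+ (c fzero ℚ.* σ ℚ.+ 0ℚ)
    ≡⟨ absorb a (c fzero) σ 0ℚ ⟩
  (a ℚ.+ c fzero) ℚ.* σ ℚ.+ 0ℚ
    ≡⟨ ℚP.+-identityʳ _ ⟩
  (a ℚ.+ c fzero) ℚ.* σ ∎
  where
  open ≡-Reasoning
  σ = ι (+ s fzero)

later-coordinate : ∀ {n} a (c : Fin (suc n) → ℚ) (s : Fin (suc n) → ℕ) i →
  a ℚ.* ι (+ s (fsuc i)) ℚ.+ sumFin (λ j → c j ℚ.* w s j (fsuc i)) ≡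
  (a ℚ.+ c fzero) ℚ.* ι (+ s (fsuc i)) ℚ.+ sumFin (λ j → c (fsuc j) ℚ.* w (tail s) j i)
later-coordinate a c s i = begin
  a ℚ.* σ ℚ.+ (c fzero ℚ.* σ ℚ.+ sumFin (λ j → c (fsuc j) ℚ.* w s (fsuc j) (fsuc i)))
    ≡⟨ cong (λ t → a ℚ.* σ ℚ.+ (c fzero ℚ.* σ ℚ.+ t))
            (sumFin-cong (λ j → cong (c (fsuc j) ℚ.*_) (w-tail s j i))) ⟩
  a ℚ.* σ ℚ.+ (c fzero ℚ.* σ ℚ.+ sumFin (λ j → c (fsuc j) ℚ.* w (tail s) j i))
    ≡⟨ absorb a (c fzero) σ _ ⟩
  (a ℚ.+ c fzero) ℚ.* σ ℚ.+ sumFin (λ j → c (fsuc j) ℚ.* w (tail s) j i) ∎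
  where
  open ≡-Reasoning
  σ = ι (+ s (fsuc i))

uncons : ∀ {n a} {s : Fin (suc n) → ℕ} {x} → ParFrom a s x →
         Σ (Step (s fzero) a (x fzero)) λ st → ParFrom (next st) (tail s) (tail x)
uncons {a = a} {s} (c , 0≤c , c<1 , eq) =
  step (a ℚ.+ c fzero) a≤a+c₁ (ℚP.+-monoʳ-< a (c<1 fzero)) (trans (eq fzero) (first-coordinate a c s)) ,
  (tail c , (λ j → 0≤c (fsuc j)) , (λ j → c<1 (fsuc j)) , λ i → trans (eq (fsuc i)) (later-coordinate a c s i))
  where
  a≤a+c₁ : a ℚ.≤ a ℚ.+ c fzero
  a≤a+c₁ = subst (ℚ._≤ a ℚ.+ c fzero) (ℚP.+-identityʳ a) (ℚP.+-monoʳ-≤ a (0≤c fzero))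

-- Conversely, an admissible first coordinate and a tail in the shifted set for
-- its offset assemble into a point of a·s + Par_s (with c_1 = b - a).
cons : ∀ {n a} {s : Fin (suc n) → ℕ} {x} (st : Step (s fzero) a (x fzero)) →
       ParFrom (next st) (tail s) (tail x) → ParFrom a s x
cons {a = a} {s} {x} (step b a≤b b<a+1 x₁≡bs₁) (c′ , 0≤c′ , c′<1 , eq′) = c , 0≤c , c<1 , eq
  where
  open +-*-Solver
  c : Fin _ → ℚ
  c = (b ℚ.- a) ∷ c′
  a+c₁≡b : a ℚ.+ c fzero ≡ b
  a+c₁≡b = solve 2 (λ a b → a :+ (b :- a) := b) refl a b
  [a+1]-a≡1 : (a ℚ.+ 1ℚ) ℚ.- a ≡ 1ℚ
  [a+1]-a≡1 = solve 1 (λ a → (a :+ con 1ℚ) :- a := con 1ℚ) refl a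
  0≤c : ∀ j → 0ℚ ℚ.≤ c j
  0≤c fzero    = subst (ℚ._≤ b ℚ.- a) (ℚP.+-inverseʳ a) (ℚP.+-monoˡ-≤ (ℚ.- a) a≤b)
  0≤c (fsuc j) = 0≤c′ j
  c<1 : ∀ j → c j ℚ.< 1ℚ
  c<1 fzero    = subst (b ℚ.- a ℚ.<_) [a+1]-a≡1 (ℚP.+-monoˡ-< (ℚ.- a) b<a+1)
  c<1 (fsuc j) = c′<1 j
  eq : ∀ i → ι (x i) ≡ a ℚ.* ι (+ s i) ℚ.+ sumFin (λ j → c j ℚ.* w s j i)
  eq fzero    = trans x₁≡bs₁ (sym (trans (first-coordinate a c s) (cong (ℚ._* ι (+ s fzero)) a+c₁≡b)))
  eq (fsuc i) = trans (eq′ i) (sym (trans (later-coordinate a c s i)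
                  (cong (λ b → b ℚ.* ι (+ s (fsuc i)) ℚ.+ sumFin (λ j → c′ j ℚ.* w (tail s) j i)) a+c₁≡b)))

-- Labels agreeing on two points of a·s + Par_s force the points to agree:
-- the first coordinates agree by injectivity on admissible coordinates, hence
-- so do the next offsets, and the tails are handled by induction.
par-injective : ∀ {n} (s : Fin n → ℕ) (G : Fin n → ℤ → ℕ) → (∀ i → ResidueLabelling (s i) (G i)) →
                ∀ {a x x′} → ParFrom a s x → ParFrom a s x′ →
                (∀ i → G i (x i) ≡ G i (x′ i)) → ∀ i → x i ≡ x′ i
par-injective {zero}  s G R p p′ same ()
par-injective {suc n} s G R {a} {x} {x′} p p′ same = coordinates
  where
  open Admissible (s fzero) {{Window.S≢0 (R fzero)}}
  first = uncons {a = a} {s} {x} p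
  first′ = uncons {a = a} {s} {x′} p′
  st = proj₁ first
  st′ = proj₁ first′
  x₁≡x₁′ : x fzero ≡ x′ fzero
  x₁≡x₁′ = step-injective (R fzero) st st′ (same fzero)
  next≡ : next st′ ≡ next st
  next≡ = scale-injective {next st′} {next st}
            (trans (sym (scaled st′)) (trans (cong ι (sym x₁≡x₁′)) (scaled st)))
  coordinates : ∀ i → x i ≡ x′ i
  coordinates fzero    = x₁≡x₁′
  coordinates (fsuc i) = par-injective (tail s) (tail G) (λ j → R (fsuc j)) {next st} {tail x} {tail x′}
    (proj₂ first) (subst (λ b → ParFrom b (tail s) (tail x′)) next≡ (proj₂ first′)) (λ j → same (fsuc j)) i

-- Every label vector in Ψ_n is attained on a·s + Par_s: choose an admissible
-- first coordinate with the right label, then recurse from the new offset.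
par-surjective : ∀ {n} (s : Fin n → ℕ) (G : Fin n → ℤ → ℕ) → (∀ i → ResidueLabelling (s i) (G i)) →
                 ∀ a y → InΨ s y → ∃ λ x → ParFrom a s x × (∀ i → G i (x i) ≡ y i)
par-surjective {zero}  s G R a y y<s = (λ ()) , ((λ ()) , (λ ()) , (λ ()) , (λ ())) , (λ ())
par-surjective {suc n} s G R a y y<s =
  let (z , st , Gz≡y) = Admissible.step-surjective (s fzero) {{Window.S≢0 (R fzero)}} a (R fzero) (y<s fzero)
      (x′ , p′ , Gx′≡y′) = par-surjective (tail s) (tail G) (λ j → R (fsuc j)) (next st) (tail y) (λ j → y<s (fsuc j))
      labels : ∀ i → G i ((z ∷ x′) i) ≡ y i
      labels = λ { fzero → Gz≡y ; (fsuc i) → Gx′≡y′ i }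
  in z ∷ x′ , cons {s = s} {x = z ∷ x′} st p′ , labels

coordinatewise-bijective : ∀ {n} (s : Fin n → ℕ) (G : Fin n → ℤ → ℕ) →
                           (∀ i → ResidueLabelling (s i) (G i)) → BijParΨ s (λ x i → G i (x i))
coordinatewise-bijective s G R =
  (λ x _ i → label<S (R i) (x i)) ,
  (λ x x′ p p′ → par-injective s G R {0ℚ} {x} {x′} (InPar⇒ParFrom0 {s = s} {x} p) (InPar⇒ParFrom0 {s = s} {x′} p′)) ,
  (λ y y<s → let (x , p , Gx≡y) = par-surjective s G R 0ℚ y y<s in x , ParFrom0⇒InPar {s = s} {x} p , Gx≡y)

-- Lemma 3.11.  In coordinate i, REM is the remainder labelling translated by q_i
-- and REM̄ is the remainder labelling reflected in q_i.
lemma3p11 : ∀ {n} (s : Fin n → ℕ) (pos : Positive s) (q : Fin n → ℕ) → InΨ s q →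
    BijParΨ s (REM s pos q) × BijParΨ s (REMbar s pos q)
lemma3p11 s pos q _ =
  coordinatewise-bijective s _ (λ i → translate (+ q i) (remainder-labelling (s i) {{>-nonZero (pos i)}})) ,
  coordinatewise-bijective s _ (λ i → reflect (+ q i) (remainder-labelling (s i) {{>-nonZero (pos i)}}))
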